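{- For every set $\Gamma$ of MSO formulas and all core-wMSO$(?,+)$ formulas $\Phi_1,\Phi_2$ in normal form, there exists a core-wMSO$(?,+)$ formula $\Phi$ in normal form such that $\Gamma\vdash\Phi\approx\Phi_1+\Phi_2$ in the core-wMSO$(?,+)$ proof system.
   Context: MSO formulas $\varphi$ over a finite alphabet $\Sigma$ (syntax $\top, P_a(x), x\le y, x\in X,\neg,\wedge,\forall x,\forall X$); step-wMSO formulas over a weight set $R$: $\Psi::=r\mid\varphi\,?\,\Psi_1:\Psi_2$. core-wMSO$(?,+)$ formulas: $\Phi::=\mathbf{0}\mid\prod_x\Psi\mid\varphi\,?\,\Phi_1:\Phi_2\mid\Phi_1+\Phi_2$. A core-wMSO$(?,+)$ formula is in normal form if generated by $N::=\varphi\,?\,N_1:N_2\mid M\mid\mathbf{0}$, $M::=\prod_x\Psi\mid M_1+M_2$. $\Gamma\vdash\varphi$ refers to a fixed sound and complete proof system for MSO over finite nonempty words. The core-wMSO$(?,+)$ proof system derives judgements $\Gamma\vdash\chi_1\approx\chi_2$ ($\chi_i$ both step-wMSO or both core-wMSO$(?,+)$ formulas) by: (ref) $\Gamma\vdash\chi\approx\chi$; (sym); (trans); (cong?) $\Gamma\vdash\chi_1\approx\chi_1'$ and $\Gamma\vdash\chi_2\approx\chi_2'$ imply $\Gamma\vdash\varphi\,?\,\chi_1:\chi_2\approx\varphi\,?\,\chi_1':\chi_2'$; (cong+) $\Gamma\vdash\Phi_1\approx\Phi_1'$ and $\Gamma\vdash\Phi_2\approx\Phi_2'$ imply $\Gamma\vdash\Phi_1+\Phi_2\approx\Phi_1'+\Phi_2'$;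 for step-wMSO formulas the rules (S1) $\Gamma\vdash\Psi_1\approx\Psi_2\Rightarrow\Gamma\cup\{\varphi\}\vdash\Psi_1\approx\Psi_2$, (S2) $\Gamma\vdash\neg\varphi\,?\,\Psi_1:\Psi_2\approx\varphi\,?\,\Psi_2:\Psi_1$, (S3) $\Gamma\vdash\varphi\Rightarrow\Gamma\vdash\varphi\,?\,\Psi_1:\Psi_2\approx\Psi_1$, (S4) $\Gamma\cup\{\varphi\}\vdash\Psi_1\approx\Psi$ and $\Gamma\cup\{\neg\varphi\}\vdash\Psi_2\approx\Psi\Rightarrow\Gamma\vdash\varphi\,?\,\Psi_1:\Psi_2\approx\Psi$; and for core formulas: (C1) $\Gamma\vdash\Phi+\mathbf{0}\approx\Phi$; (C2) $\Gamma\vdash\Phi_1+\Phi_2\approx\Phi_2+\Phi_1$; (C3) $\Gamma\vdash(\Phi_1+\Phi_2)+\Phi_3\approx\Phi_1+(\Phi_2+\Phi_3)$; (C4) if $\Gamma\vdash\Psi_1\approx\Psi_2$ and $x$ is not free in $\Gamma$ then $\Gamma\vdash\prod_x\Psi_1\approx\prod_x\Psi_2$; (C5) $\Gamma\vdash\prod_x\Psi\approx\prod_y\Psi[y/x]$ if $y$ does not occur in $\Psi$; (C6)–(C9) the analogues of (S1)–(S4) with core formulas $\Phi$ in place of $\Psi$; (C10) $\Gamma\vdash(\varphi\,?\,\Phi':\Phi'')+\Phi\approx\varphi\,?\,(\Phi'+\Phi):(\Phi''+\Phi)$. -}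

module Defs where

open import Data.Nat using (ℕ; suc)
open import Data.Nat.Properties using (_≟_)
open import Data.Fin using (Fin) renaming (_≤_ to _≤ᶠ_)
open import Data.Vec using (Vec; lookup)
open import Data.Bool using (Bool; true; if_then_else_)
open import Data.Product using (_×_)
open import Data.Sum using (_⊎_)
open import Data.Empty using (⊥)
open import Relation.Nullary using (¬_; does)
open import Relation.Binary.PropositionalEquality using (_≡_)

-- Alphabet Σ = Fin k (a finite alphabet).  First-order variables and
-- second-order variables are both named by natural numbers (separate sorts).
Var : Set
Var = ℕ

SVar : Set
SVar = ℕ

data MSO (k : ℕ) : Set where
  ⊤'   : MSO k
  P    : Fin k → Var → MSO k
  _≤'_ : Var → Var → MSO k
  _∈'_ : Var → SVar → MSO k
  ¬'_  : MSO k → MSO k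
  _∧'_ : MSO k → MSO k → MSO k
  ∀₁   : Var → MSO k → MSO k
  ∀₂   : SVar → MSO k → MSO k

-- Semantics over finite nonempty words w of length suc n
-- (positions Fin (suc n)), with a first-order valuation σ₁ and a
-- second-order valuation σ₂ (sets of positions as characteristic functions).
_[_↦_] : {A : Set} → (ℕ → A) → ℕ → A → (ℕ → A)
(σ [ x ↦ a ]) y = if does (y ≟ x) then a else σ y

Sat : ∀ {k n} → Vec (Fin k) (suc n) → (Var → Fin (suc n)) →
      (SVar → Fin (suc n) → Bool) → MSO k → Set
Sat w σ₁ σ₂ ⊤'        = Data.Unit.⊤ where import Data.Unit
Sat w σ₁ σ₂ (P a x)   = lookup w (σ₁ x) ≡ a
Sat w σ₁ σ₂ (x ≤' y)  = σ₁ x ≤ᶠ σ₁ y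
Sat w σ₁ σ₂ (x ∈' X)  = σ₂ X (σ₁ x) ≡ true
Sat w σ₁ σ₂ (¬' φ)    = ¬ Sat w σ₁ σ₂ φ
Sat w σ₁ σ₂ (φ ∧' ψ)  = Sat w σ₁ σ₂ φ × Sat w σ₁ σ₂ ψ
Sat w σ₁ σ₂ (∀₁ x φ)  = ∀ i → Sat w (σ₁ [ x ↦ i ]) σ₂ φ
Sat w σ₁ σ₂ (∀₂ X φ)  = ∀ S → Sat w σ₁ (σ₂ [ X ↦ S ]) φ

Ctx : ℕ → Set₁
Ctx k = MSO k → Set

_∪｛_｝ : ∀ {k} → Ctx k → MSO k → Ctx k
(Γ ∪｛ φ ｝) ψ = Γ ψ ⊎ ψ ≡ φ

-- Γ ⊢ φ : the fixed sound and complete MSO proof system over finite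
-- nonempty words.  By soundness and completeness it coincides with
-- semantic consequence, which we take as its definition.
_⊢MSO_ : ∀ {k} → Ctx k → MSO k → Set
_⊢MSO_ {k} Γ φ = ∀ n (w : Vec (Fin k) (suc n)) σ₁ σ₂ →
  (∀ ψ → Γ ψ → Sat w σ₁ σ₂ ψ) → Sat w σ₁ σ₂ φ

data FreeIn {k} (x : Var) : MSO k → Set where
  fP    : ∀ {a} → FreeIn x (P a x)
  f≤ˡ   : ∀ {y} → FreeIn x (x ≤' y)
  f≤ʳ   : ∀ {y} → FreeIn x (y ≤' x)
  f∈    : ∀ {X} → FreeIn x (x ∈' X)
  f¬    : ∀ {φ} → FreeIn x φ → FreeIn x (¬' φ)
  f∧ˡ   : ∀ {φ ψ} → FreeIn x φ → FreeIn x (φ ∧' ψ)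
  f∧ʳ   : ∀ {φ ψ} → FreeIn x ψ → FreeIn x (φ ∧' ψ)
  f∀₁   : ∀ {y φ} → ¬ (x ≡ y) → FreeIn x φ → FreeIn x (∀₁ y φ)
  f∀₂   : ∀ {X φ} → FreeIn x φ → FreeIn x (∀₂ X φ)

data OccIn {k} (x : Var) : MSO k → Set where
  oP    : ∀ {a} → OccIn x (P a x)
  o≤ˡ   : ∀ {y} → OccIn x (x ≤' y)
  o≤ʳ   : ∀ {y} → OccIn x (y ≤' x)
  o∈    : ∀ {X} → OccIn x (x ∈' X)
  o¬    : ∀ {φ} → OccIn x φ → OccIn x (¬' φ)
  o∧ˡ   : ∀ {φ ψ} → OccIn x φ → OccIn x (φ ∧' ψ)
  o∧ʳ   : ∀ {φ ψ} → OccIn x ψ → OccIn x (φ ∧' ψ)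
  o∀b   : ∀ {φ} → OccIn x (∀₁ x φ)
  o∀₁   : ∀ {y φ} → OccIn x φ → OccIn x (∀₁ y φ)
  o∀₂   : ∀ {X φ} → OccIn x φ → OccIn x (∀₂ X φ)

rv : Var → Var → Var → Var
rv y x z = if does (z ≟ x) then y else z

_[_/_]ᵐ : ∀ {k} → MSO k → Var → Var → MSO k
⊤' [ y / x ]ᵐ       = ⊤'
P a z [ y / x ]ᵐ    = P a (rv y x z)
(z ≤' u) [ y / x ]ᵐ = rv y x z ≤' rv y x u
(z ∈' X) [ y / x ]ᵐ = rv y x z ∈' X
(¬' φ) [ y / x ]ᵐ   = ¬' (φ [ y / x ]ᵐ)
(φ ∧' ψ) [ y / x ]ᵐ = (φ [ y / x ]ᵐ) ∧' (ψ [ y / x ]ᵐ)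
∀₁ z φ [ y / x ]ᵐ   = if does (z ≟ x) then ∀₁ z φ else ∀₁ z (φ [ y / x ]ᵐ)
∀₂ X φ [ y / x ]ᵐ   = ∀₂ X (φ [ y / x ]ᵐ)

data Step (k : ℕ) (R : Set) : Set where
  wt  : R → Step k R
  _⁇ˢ_∶_ : MSO k → Step k R → Step k R → Step k R

OccInStep : ∀ {k R} → Var → Step k R → Set
OccInStep x (wt r)        = ⊥
OccInStep x (φ ⁇ˢ Ψ₁ ∶ Ψ₂) = OccIn x φ ⊎ OccInStep x Ψ₁ ⊎ OccInStep x Ψ₂

_[_/_]ˢ : ∀ {k R} → Step k R → Var → Var → Step k R
wt r [ y / x ]ˢ           = wt r
(φ ⁇ˢ Ψ₁ ∶ Ψ₂) [ y / x ]ˢ = (φ [ y / x ]ᵐ) ⁇ˢ (Ψ₁ [ y / x ]ˢ) ∶ (Ψ₂ [ y / x ]ˢ)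

data Core (k : ℕ) (R : Set) : Set where
  𝟎      : Core k R
  Π      : Var → Step k R → Core k R
  _⁇_∶_  : MSO k → Core k R → Core k R → Core k R
  _⊕_    : Core k R → Core k R → Core k R

data IsM {k R} : Core k R → Set where
  mΠ : ∀ {x Ψ} → IsM (Π x Ψ)
  m⊕ : ∀ {Φ₁ Φ₂} → IsM Φ₁ → IsM Φ₂ → IsM (Φ₁ ⊕ Φ₂)

data IsN {k R} : Core k R → Set where
  n? : ∀ {φ Φ₁ Φ₂} → IsN Φ₁ → IsN Φ₂ → IsN (φ ⁇ Φ₁ ∶ Φ₂)
  nM : ∀ {Φ} → IsM Φ → IsN Φ
  n𝟎 : IsN 𝟎

NotFreeIn : ∀ {k} → Var → Ctx k → Set
NotFreeIn x Γ = ∀ φ → Γ φ → ¬ FreeIn x φ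

data _⊢ˢ_≈_ {k R} : Ctx k → Step k R → Step k R → Set₁ where
  ref   : ∀ {Γ Ψ} → Γ ⊢ˢ Ψ ≈ Ψ
  sym'  : ∀ {Γ Ψ₁ Ψ₂} → Γ ⊢ˢ Ψ₁ ≈ Ψ₂ → Γ ⊢ˢ Ψ₂ ≈ Ψ₁
  trans' : ∀ {Γ Ψ₁ Ψ₂ Ψ₃} → Γ ⊢ˢ Ψ₁ ≈ Ψ₂ → Γ ⊢ˢ Ψ₂ ≈ Ψ₃ → Γ ⊢ˢ Ψ₁ ≈ Ψ₃
  cong? : ∀ {Γ φ Ψ₁ Ψ₁' Ψ₂ Ψ₂'} → Γ ⊢ˢ Ψ₁ ≈ Ψ₁' → Γ ⊢ˢ Ψ₂ ≈ Ψ₂' →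
          Γ ⊢ˢ (φ ⁇ˢ Ψ₁ ∶ Ψ₂) ≈ (φ ⁇ˢ Ψ₁' ∶ Ψ₂')
  S1 : ∀ {Γ φ Ψ₁ Ψ₂} → Γ ⊢ˢ Ψ₁ ≈ Ψ₂ → (Γ ∪｛ φ ｝) ⊢ˢ Ψ₁ ≈ Ψ₂
  S2 : ∀ {Γ φ Ψ₁ Ψ₂} → Γ ⊢ˢ ((¬' φ) ⁇ˢ Ψ₁ ∶ Ψ₂) ≈ (φ ⁇ˢ Ψ₂ ∶ Ψ₁)
  S3 : ∀ {Γ φ Ψ₁ Ψ₂} → Γ ⊢MSO φ → Γ ⊢ˢ (φ ⁇ˢ Ψ₁ ∶ Ψ₂) ≈ Ψ₁
  S4 : ∀ {Γ φ Ψ₁ Ψ₂ Ψ} → (Γ ∪｛ φ ｝) ⊢ˢ Ψ₁ ≈ Ψ → (Γ ∪｛ ¬' φ ｝) ⊢ˢ Ψ₂ ≈ Ψ →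
       Γ ⊢ˢ (φ ⁇ˢ Ψ₁ ∶ Ψ₂) ≈ Ψ

data _⊢_≈_ {k R} : Ctx k → Core k R → Core k R → Set₁ where
  ref   : ∀ {Γ Φ} → Γ ⊢ Φ ≈ Φ
  sym'  : ∀ {Γ Φ₁ Φ₂} → Γ ⊢ Φ₁ ≈ Φ₂ → Γ ⊢ Φ₂ ≈ Φ₁
  trans' : ∀ {Γ Φ₁ Φ₂ Φ₃} → Γ ⊢ Φ₁ ≈ Φ₂ → Γ ⊢ Φ₂ ≈ Φ₃ → Γ ⊢ Φ₁ ≈ Φ₃
  cong? : ∀ {Γ φ Φ₁ Φ₁' Φ₂ Φ₂'} → Γ ⊢ Φ₁ ≈ Φ₁' → Γ ⊢ Φ₂ ≈ Φ₂' →
          Γ ⊢ (φ ⁇ Φ₁ ∶ Φ₂) ≈ (φ ⁇ Φ₁' ∶ Φ₂')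
  cong+ : ∀ {Γ Φ₁ Φ₁' Φ₂ Φ₂'} → Γ ⊢ Φ₁ ≈ Φ₁' → Γ ⊢ Φ₂ ≈ Φ₂' →
          Γ ⊢ (Φ₁ ⊕ Φ₂) ≈ (Φ₁' ⊕ Φ₂')
  C1 : ∀ {Γ Φ} → Γ ⊢ (Φ ⊕ 𝟎) ≈ Φ
  C2 : ∀ {Γ Φ₁ Φ₂} → Γ ⊢ (Φ₁ ⊕ Φ₂) ≈ (Φ₂ ⊕ Φ₁)
  C3 : ∀ {Γ Φ₁ Φ₂ Φ₃} → Γ ⊢ ((Φ₁ ⊕ Φ₂) ⊕ Φ₃) ≈ (Φ₁ ⊕ (Φ₂ ⊕ Φ₃))
  C4 : ∀ {Γ x Ψ₁ Ψ₂} → Γ ⊢ˢ Ψ₁ ≈ Ψ₂ → NotFreeIn x Γ → Γ ⊢ Π x Ψ₁ ≈ Π x Ψ₂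
  C5 : ∀ {Γ x y Ψ} → ¬ OccInStep y Ψ → Γ ⊢ Π x Ψ ≈ Π y (Ψ [ y / x ]ˢ)
  C6 : ∀ {Γ φ Φ₁ Φ₂} → Γ ⊢ Φ₁ ≈ Φ₂ → (Γ ∪｛ φ ｝) ⊢ Φ₁ ≈ Φ₂
  C7 : ∀ {Γ φ Φ₁ Φ₂} → Γ ⊢ ((¬' φ) ⁇ Φ₁ ∶ Φ₂) ≈ (φ ⁇ Φ₂ ∶ Φ₁)
  C8 : ∀ {Γ φ Φ₁ Φ₂} → Γ ⊢MSO φ → Γ ⊢ (φ ⁇ Φ₁ ∶ Φ₂) ≈ Φ₁
  C9 : ∀ {Γ φ Φ₁ Φ₂ Φ} → (Γ ∪｛ φ ｝) ⊢ Φ₁ ≈ Φ → (Γ ∪｛ ¬' φ ｝) ⊢ Φ₂ ≈ Φ →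
       Γ ⊢ (φ ⁇ Φ₁ ∶ Φ₂) ≈ Φ
  C10 : ∀ {Γ φ Φ' Φ'' Φ} → Γ ⊢ ((φ ⁇ Φ' ∶ Φ'') ⊕ Φ) ≈ (φ ⁇ (Φ' ⊕ Φ) ∶ (Φ'' ⊕ Φ))

module Submission where

open import Defs
open import Data.Nat using (ℕ)
open import Data.Product using (Σ; _×_; _,_)

-- A conditional absorbs a summand on either side (C10, and C10 conjugated
-- by commutativity); so the sum is pushed into the branches of whichever
-- summand is a conditional, and the base cases are sums of two M-formulas
-- (already normal) or sums with 𝟎 (removed by C1).

NormalFormOf : ∀ {k R} → Ctx k → Core k R → Set₁
NormalFormOf {k} {R} Γ Φ = Σ (Core k R) (λ N → IsN N × (Γ ⊢ N ≈ Φ))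

module _ {k : ℕ} {R : Set} {Γ : Ctx k} where

  ⊕-distribˡ-⁇ : ∀ {φ} {Φ Φ' Φ'' : Core k R} →
    Γ ⊢ (Φ ⊕ (φ ⁇ Φ' ∶ Φ'')) ≈ (φ ⁇ (Φ ⊕ Φ') ∶ (Φ ⊕ Φ''))
  ⊕-distribˡ-⁇ = trans' C2 (trans' C10 (cong? C2 C2))

  𝟎-identityˡ : ∀ {Φ : Core k R} → Γ ⊢ (𝟎 ⊕ Φ) ≈ Φ
  𝟎-identityˡ = trans' C2 C1

  normal-⊕ˡ-M : ∀ (M Φ : Core k R) → IsM M → IsN Φ → NormalFormOf Γ (M ⊕ Φ)
  normal-⊕ˡ-M M (φ ⁇ A ∶ B) m (n? a b)
    with normal-⊕ˡ-M M A m a | normal-⊕ˡ-M M B m b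
  ... | X , nx , X≈ | Y , ny , Y≈ =
    (φ ⁇ X ∶ Y) , n? nx ny , trans' (cong? X≈ Y≈) (sym' ⊕-distribˡ-⁇)
  normal-⊕ˡ-M M Φ m (nM m') = (M ⊕ Φ) , nM (m⊕ m m') , ref
  normal-⊕ˡ-M M 𝟎 m n𝟎 = M , nM m , sym' C1

  normal-⊕ : ∀ (Φ₁ Φ₂ : Core k R) → IsN Φ₁ → IsN Φ₂ → NormalFormOf Γ (Φ₁ ⊕ Φ₂)
  normal-⊕ (φ ⁇ A ∶ B) Φ₂ (n? a b) n₂
    with normal-⊕ A Φ₂ a n₂ | normal-⊕ B Φ₂ b n₂
  ... | X , nx , X≈ | Y , ny , Y≈ =
    (φ ⁇ X ∶ Y) , n? nx ny , trans' (cong? X≈ Y≈) (sym' C10)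
  normal-⊕ Φ₁ Φ₂ (nM m) n₂ = normal-⊕ˡ-M Φ₁ Φ₂ m n₂
  normal-⊕ 𝟎 Φ₂ n𝟎 n₂ = Φ₂ , n₂ , sym' 𝟎-identityˡ

lemma5 : ∀ {k : ℕ} {R : Set} (Γ : Ctx k) (Φ₁ Φ₂ : Core k R) →
    IsN Φ₁ → IsN Φ₂ → Σ (Core k R) (λ Φ → IsN Φ × (Γ ⊢ Φ ≈ (Φ₁ ⊕ Φ₂)))
lemma5 Γ = normal-⊕
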